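{- Let $n\ge 2$ be an integer and $D=11\times(10^{2^n}-1)$. Then $D$ has at least $n+1$ (distinct) divisors that are Ball magic numbers.
   Context: Ball magic number: let $N\ge 2$ and let $x$ be a positive integer with exactly $N$ decimal digits, $x=a_{N-1}\dots a_0$ with $a_{N-1}\neq 0$, which is not a palindrome. Its reverse $x'$ is the integer with digit string $a_0a_1\dots a_{N-1}$ (leading zeros allowed). Let $y=|x-x'|$, written as an $N$-digit string $b_{N-1}\dots b_0$ (leading zeros allowed), and let $y'$ be the integer with digit string $b_0\dots b_{N-1}$. The nonzero integer $B=y+y'$ is a Ball magic number; a Ball magic number is any integer obtained this way from some such $x$. -}

module Defs where

open import Data.Nat using (ℕ; zero; suc; _+_; _*_; _^_; _≤_; _<_)
open import Data.Nat.DivMod using (_/_; _%_)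
open import Data.Nat.Base using (∣_-_∣)
open import Data.List using (List; []; _∷_; reverse)
open import Data.Product using (Σ; _×_; ∃)
open import Relation.Binary.PropositionalEquality using (_≡_)
open import Relation.Nullary using (¬_)

-- The N-digit decimal string of x (leading zeros allowed),
-- listed least significant digit first: a₀ ∷ a₁ ∷ … ∷ a_{N-1}.
digits : ℕ → ℕ → List ℕ
digits zero    x = []
digits (suc N) x = x % 10 ∷ digits N (x / 10)

fromDigits : List ℕ → ℕ
fromDigits []       = 0
fromDigits (d ∷ ds) = d + 10 * fromDigits ds

revN : ℕ → ℕ → ℕ
revN N x = fromDigits (reverse (digits N x))

-- B is a Ball magic number: obtained from some x with exactly N ≥ 2 digits,
-- x not a palindrome, via y = |x - x'|, B = y + y'.
BallMagic : ℕ → Set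
BallMagic B =
  Σ ℕ λ N → 2 ≤ N × Σ ℕ λ x →
    10 ^ (N Data.Nat.∸ 1) ≤ x × x < 10 ^ N ×
    ¬ (x ≡ revN N x) ×
    B ≡ ∣ x - revN N x ∣ + revN N ∣ x - revN N x ∣

-- For m ≥ 1 take x = 10ᵐ with m + 1 digits: then x' = 1,
-- y = 10ᵐ − 1 has the digit string 0 9…9, so y' = 9…90 = 10 y and B = 11 (10ᵐ − 1).
-- Since 10ᵃ − 1 ∣ 10ᵇ − 1 whenever a ∣ b, the n + 1 numbers 11 (10^(2ᵏ) − 1),
-- 0 ≤ k ≤ n, are distinct Ball magic divisors of 11 (10^(2ⁿ) − 1).
module Submission where

open import Defs
open import Data.Nat using (ℕ; zero; suc; _+_; _*_; _^_; _∸_; _≤_; _<_; z≤n; s≤s; ∣_-_∣)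
open import Data.Nat.Properties
open import Data.Nat.DivMod using (_/_; _%_; [m+kn]%n≡m%n; m<n⇒m%n≡m; +-distrib-/; m<n⇒m/n≡0; m*n/n≡m; m*n%n≡0)
open import Data.Nat.Divisibility using (_∣_; divides; _∣0; ∣-refl; ∣m∣n⇒∣m+n; ∣n⇒∣m*n; *-monoʳ-∣)
open import Data.Nat.Tactic.RingSolver using (solve-∀)
open import Data.List using (List; []; _∷_; _∷ʳ_; length; reverse; map; upTo)
open import Data.List.Properties using (unfold-reverse; length-reverse; length-map; length-upTo)
open import Data.List.Relation.Unary.All as All using (All)
import Data.List.Relation.Unary.All.Properties as Allₚ
open import Data.List.Relation.Unary.Unique.Propositional using (Unique)
import Data.List.Relation.Unary.Unique.Propositional.Properties as Uniqueₚ
open import Data.Product using (Σ; _×_; _,_)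
open import Function using (_∘_)
open import Relation.Binary.Definitions using (Monotonic₁; tri<; tri≈; tri>)
open import Relation.Binary.PropositionalEquality
  using (_≡_; refl; sym; trans; cong; cong₂; subst; module ≡-Reasoning)
open import Relation.Nullary using (¬_; contradiction)

open ≡-Reasoning

strictlyMonotonic⇒injective : ∀ {f : ℕ → ℕ} → Monotonic₁ _<_ _<_ f →
                              ∀ {m n} → f m ≡ f n → m ≡ n
strictlyMonotonic⇒injective mono {m} {n} eq with <-cmp m n
... | tri< m<n _ _ = contradiction eq (<⇒≢ (mono m<n))
... | tri≈ _ m≡n _ = m≡n
... | tri> _ _ n<m = contradiction eq (>⇒≢ (mono n<m))

^-injectiveʳ : ∀ m → 1 < m → ∀ {a b} → m ^ a ≡ m ^ b → a ≡ b
^-injectiveʳ m 1<m = strictlyMonotonic⇒injective (^-monoʳ-< m 1<m)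

^-monoʳ-∣ : ∀ m {k n} → k ≤ n → m ^ k ∣ m ^ n
^-monoʳ-∣ m {k} {n} k≤n = divides (m ^ (n ∸ k)) (begin
  m ^ n                   ≡⟨ cong (m ^_) (m+[n∸m]≡n k≤n) ⟨
  m ^ (k + (n ∸ k))       ≡⟨ ^-distribˡ-+-* m k (n ∸ k) ⟩
  m ^ k * m ^ (n ∸ k)     ≡⟨ *-comm (m ^ k) (m ^ (n ∸ k)) ⟩
  m ^ (n ∸ k) * m ^ k     ∎)

nines : ℕ → ℕ
nines zero    = 0
nines (suc m) = 9 + 10 * nines m

10^≡1+nines : ∀ m → 10 ^ m ≡ suc (nines m)
10^≡1+nines zero    = refl
10^≡1+nines (suc m) = begin
  10 * 10 ^ m          ≡⟨ cong (10 *_) (10^≡1+nines m) ⟩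
  10 * suc (nines m)   ≡⟨ shift (nines m) ⟩
  suc (9 + 10 * nines m) ∎
  where
  shift : ∀ a → 10 * suc a ≡ suc (9 + 10 * a)
  shift = solve-∀

nines≡10^∸1 : ∀ m → nines m ≡ 10 ^ m ∸ 1
nines≡10^∸1 m = cong (_∸ 1) (sym (10^≡1+nines m))

nines-injective : ∀ {a b} → nines a ≡ nines b → a ≡ b
nines-injective {a} {b} eq = ^-injectiveʳ 10 (s≤s (s≤s z≤n)) (begin
  10 ^ a         ≡⟨ 10^≡1+nines a ⟩
  suc (nines a)  ≡⟨ cong suc eq ⟩
  suc (nines b)  ≡⟨ 10^≡1+nines b ⟨
  10 ^ b         ∎)

nines-+ : ∀ a b → nines (a + b) ≡ nines a + 10 ^ a * nines b
nines-+ zero    b = sym (+-identityʳ (nines b))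
nines-+ (suc a) b = begin
  9 + 10 * nines (a + b)                   ≡⟨ cong (λ t → 9 + 10 * t) (nines-+ a b) ⟩
  9 + 10 * (nines a + 10 ^ a * nines b)    ≡⟨ distrib (nines a) (10 ^ a) (nines b) ⟩
  (9 + 10 * nines a) + 10 * 10 ^ a * nines b ∎
  where
  distrib : ∀ x p y → 9 + 10 * (x + p * y) ≡ (9 + 10 * x) + 10 * p * y
  distrib = solve-∀

nines-∣-nines* : ∀ a q → nines a ∣ nines (q * a)
nines-∣-nines* a zero    = nines a ∣0
nines-∣-nines* a (suc q) = subst (nines a ∣_) (sym (nines-+ a (q * a)))
  (∣m∣n⇒∣m+n ∣-refl (∣n⇒∣m*n (10 ^ a) (nines-∣-nines* a q)))

nines-∣ : ∀ {a b} → a ∣ b → nines a ∣ nines b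
nines-∣ {a} (divides q refl) = nines-∣-nines* a q

lastDigit : ∀ {d} a → d < 10 → (d + 10 * a) % 10 ≡ d
lastDigit {d} a d<10 = begin
  (d + 10 * a) % 10  ≡⟨ cong (λ t → (d + t) % 10) (*-comm 10 a) ⟩
  (d + a * 10) % 10  ≡⟨ [m+kn]%n≡m%n d a 10 ⟩
  d % 10             ≡⟨ m<n⇒m%n≡m d<10 ⟩
  d                  ∎

dropLastDigit : ∀ {d} a → d < 10 → (d + 10 * a) / 10 ≡ a
dropLastDigit {d} a d<10 = begin
  (d + 10 * a) / 10     ≡⟨ cong (λ t → (d + t) / 10) (*-comm 10 a) ⟩
  (d + a * 10) / 10     ≡⟨ +-distrib-/ d (a * 10) noCarry ⟩
  d / 10 + a * 10 / 10  ≡⟨ cong₂ _+_ (m<n⇒m/n≡0 d<10) (m*n/n≡m a 10) ⟩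
  a                     ∎
  where
  noCarry : d % 10 + a * 10 % 10 < 10
  noCarry = subst (_< 10) (sym (trans (cong₂ _+_ (m<n⇒m%n≡m d<10) (m*n%n≡0 a 10)) (+-identityʳ d))) d<10

digits-suc : ∀ N {d} a → d < 10 → digits (suc N) (d + 10 * a) ≡ d ∷ digits N a
digits-suc N a d<10 = cong₂ _∷_ (lastDigit a d<10) (cong (digits N) (dropLastDigit a d<10))

length-digits : ∀ N x → length (digits N x) ≡ N
length-digits zero    x = refl
length-digits (suc N) x = cong suc (length-digits N (x / 10))

fromDigits-∷ʳ : ∀ ds d → fromDigits (ds ∷ʳ d) ≡ fromDigits ds + 10 ^ length ds * d
fromDigits-∷ʳ []       d = refl
fromDigits-∷ʳ (e ∷ ds) d = begin
  e + 10 * fromDigits (ds ∷ʳ d)                   ≡⟨ cong (λ t → e + 10 * t) (fromDigits-∷ʳ ds d) ⟩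
  e + 10 * (fromDigits ds + 10 ^ length ds * d)   ≡⟨ distrib e (fromDigits ds) (10 ^ length ds) d ⟩
  (e + 10 * fromDigits ds) + 10 * 10 ^ length ds * d ∎
  where
  distrib : ∀ e f p d → e + 10 * (f + p * d) ≡ (e + 10 * f) + 10 * p * d
  distrib = solve-∀

revN-suc : ∀ N {d} a → d < 10 → revN (suc N) (d + 10 * a) ≡ revN N a + 10 ^ N * d
revN-suc N {d} a d<10 = begin
  fromDigits (reverse (digits (suc N) (d + 10 * a)))  ≡⟨ cong (fromDigits ∘ reverse) (digits-suc N a d<10) ⟩
  fromDigits (reverse (d ∷ ds))                       ≡⟨ cong fromDigits (unfold-reverse d ds) ⟩
  fromDigits (reverse ds ∷ʳ d)                        ≡⟨ fromDigits-∷ʳ (reverse ds) d ⟩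
  revN N a + 10 ^ length (reverse ds) * d             ≡⟨ cong (λ l → revN N a + 10 ^ l * d) length≡N ⟩
  revN N a + 10 ^ N * d                               ∎
  where
  ds = digits N a
  length≡N : length (reverse ds) ≡ N
  length≡N = trans (length-reverse ds) (length-digits N a)

revN-10^ : ∀ m → revN (suc m) (10 ^ m) ≡ 1
revN-10^ zero    = refl
revN-10^ (suc m) = begin
  revN (suc (suc m)) (0 + 10 * 10 ^ m)    ≡⟨ revN-suc (suc m) (10 ^ m) (s≤s z≤n) ⟩
  revN (suc m) (10 ^ m) + 10 ^ suc m * 0  ≡⟨ cong (revN (suc m) (10 ^ m) +_) (*-zeroʳ (10 ^ suc m)) ⟩
  revN (suc m) (10 ^ m) + 0               ≡⟨ +-identityʳ _ ⟩
  revN (suc m) (10 ^ m)                   ≡⟨ revN-10^ m ⟩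
  1                                       ∎

revN-nines : ∀ m → revN (suc m) (nines m) ≡ 10 * nines m
revN-nines zero    = refl
revN-nines (suc m) = begin
  revN (suc (suc m)) (9 + 10 * nines m)     ≡⟨ revN-suc (suc m) (nines m) (n<1+n 9) ⟩
  revN (suc m) (nines m) + 10 ^ suc m * 9   ≡⟨ cong₂ (λ r p → r + 10 * p * 9) (revN-nines m) (10^≡1+nines m) ⟩
  10 * nines m + 10 * suc (nines m) * 9     ≡⟨ shift (nines m) ⟩
  10 * (9 + 10 * nines m)                   ∎
  where
  shift : ∀ a → 10 * a + 10 * suc a * 9 ≡ 10 * (9 + 10 * a)
  shift = solve-∀

ballMagic-11*nines : ∀ m → 1 ≤ m → BallMagic (11 * nines m)
ballMagic-11*nines m 1≤m =
  suc m , s≤s 1≤m , 10 ^ m , ≤-refl , ^-monoʳ-< 10 1<10 (n<1+n m) , notPalindrome , ball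
  where
  1<10 : 1 < 10
  1<10 = s≤s (s≤s z≤n)
  x' = revN (suc m) (10 ^ m)
  y = ∣ 10 ^ m - x' ∣

  notPalindrome : ¬ (10 ^ m ≡ x')
  notPalindrome eq = >⇒≢ (^-monoʳ-< 10 1<10 1≤m) (trans eq (revN-10^ m))

  y≡nines : y ≡ nines m
  y≡nines = begin
    ∣ 10 ^ m - x' ∣           ≡⟨ cong₂ ∣_-_∣ (10^≡1+nines m) (revN-10^ m) ⟩
    ∣ suc (nines m) - 1 ∣     ≡⟨ m≤n⇒∣n-m∣≡n∸m (s≤s z≤n) ⟩
    nines m                   ∎

  ball : 11 * nines m ≡ y + revN (suc m) y
  ball = begin
    11 * nines m                    ≡⟨ split (nines m) ⟩
    nines m + 10 * nines m          ≡⟨ cong (nines m +_) (revN-nines m) ⟨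
    nines m + revN (suc m) (nines m) ≡⟨ cong (λ t → t + revN (suc m) t) y≡nines ⟨
    y + revN (suc m) y              ∎
    where
    split : ∀ a → 11 * a ≡ a + 10 * a
    split = solve-∀

magicDivisor : ℕ → ℕ
magicDivisor k = 11 * nines (2 ^ k)

magicDivisor-injective : ∀ {j k} → magicDivisor j ≡ magicDivisor k → j ≡ k
magicDivisor-injective = ^-injectiveʳ 2 (n<1+n 1) ∘ nines-injective ∘ *-cancelˡ-≡ _ _ 11

magicDivisor-∣ : ∀ {k n} → k ≤ n → magicDivisor k ∣ 11 * (10 ^ (2 ^ n) ∸ 1)
magicDivisor-∣ {k} {n} k≤n = *-monoʳ-∣ 11
  (subst (nines (2 ^ k) ∣_) (nines≡10^∸1 (2 ^ n)) (nines-∣ (^-monoʳ-∣ 2 k≤n)))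

theorem22 : (n : ℕ) → 2 ≤ n →
    Σ (List ℕ) λ ds →
      Unique ds × suc n ≤ length ds ×
      All (λ d → d ∣ 11 * (10 ^ (2 ^ n) ∸ 1) × BallMagic d) ds
theorem22 n _ =
  map magicDivisor ks ,
  Uniqueₚ.map⁺ magicDivisor-injective (Uniqueₚ.upTo⁺ (suc n)) ,
  ≤-reflexive (sym (trans (length-map magicDivisor ks) (length-upTo (suc n)))) ,
  Allₚ.map⁺ (All.map magicDivisor-properties (Allₚ.all-upTo (suc n)))
  where
  ks = upTo (suc n)
  magicDivisor-properties : ∀ {k} → k < suc n →
    magicDivisor k ∣ 11 * (10 ^ (2 ^ n) ∸ 1) × BallMagic (magicDivisor k)
  magicDivisor-properties {k} k<1+n =
    magicDivisor-∣ (≤-pred k<1+n) , ballMagic-11*nines (2 ^ k) (m^n>0 2 k)
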